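{- Let $\sigma$ be a System T type, let $x\in\mathcal{B}[\![\sigma]\!]$, and let $t,s$ be families assigning to each System T type $A$ closed terms $t_A,s_A$ of type $\lceil\sigma\rceil_A$. If for all $A$ we have $[\![t_A]\!]\approx_{\lceil\sigma\rceil_A}[\![s_A]\!]$, then $R_\sigma(x,t)$ implies $R_\sigma(x,s)$.
   Context: Metatheory: constructive Martin-Löf type theory without function extensionality. System T types: base $\iota$ and $\sigma\Rightarrow\tau$; closed terms as usual (variables, $\mathsf{zero}$, $\mathsf{succ}$, $\mathsf{rec}_\sigma$, $\lambda$, application). Set interpretation $[\![\iota]\!]=\mathbb{N}$, $[\![\sigma\Rightarrow\tau]\!]=[\![\sigma]\!]\to[\![\tau]\!]$, with the standard interpretation of terms ($\mathsf{rec}$ as primitive recursion). Hereditarily extensional equality: $n\approx_\iota m$ iff $n=m$; $f\approx_{\sigma_1\Rightarrow\sigma_2}g$ iff $\forall x,y$, $x\approx_{\sigma_1}y\Rightarrow f\,x\approx_{\sigma_2}g\,y$. Dialogue trees $\mathcal{D}_{\mathbb N}\mathbb{N}$: inductive type with constructors $\eta\,n$ ($n\in\mathbb{N}$) and $\beta\,\varphi\,i$ ($\varphi:\mathbb{N}\to\mathcal{D}_{\mathbb N}\mathbb{N}$, $i\in\mathbb{N}$). $\mathcal{B}[\![\iota]\!]=\mathcal{D}_{\mathbb N}\mathbb{N}$, $\mathcal{B}[\![\sigma\Rightarrow\tau]\!]=\mathcal{B}[\![\sigma]\!]\to\mathcal{B}[\![\tau]\!]$. Internal trees: for System T types $A,\sigma$,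 $\mathsf{ChD}_A(\sigma):=(\sigma\Rightarrow A)\Rightarrow((\iota\Rightarrow A)\Rightarrow\iota\Rightarrow A)\Rightarrow A$; $\eta_A:=\lambda z\,e\,b.\,e\,z$; $\beta_A:=\lambda\varphi\,x\,e\,b.\,b\,(\lambda y.\varphi\,y\,e\,b)\,x$. Type translation $\lceil\iota\rceil_A=\mathsf{ChD}_A(\iota)$, $\lceil\sigma\Rightarrow\tau\rceil_A=\lceil\sigma\rceil_A\Rightarrow\lceil\tau\rceil_A$. Encoding $\mathsf{enc}_A:\mathcal{D}_{\mathbb N}\mathbb{N}\to[\![\mathsf{ChD}_A(\iota)]\!]$: $\mathsf{enc}_A(\eta\,z)=[\![\eta_A]\!]\,z$, $\mathsf{enc}_A(\beta\,\varphi\,x)=[\![\beta_A]\!]\,(\mathsf{enc}_A\circ\varphi)\,x$. Logical relation $R_\sigma(x,y)$ for $x\in\mathcal{B}[\![\sigma]\!]$ and $y$ a family of closed terms $y_A:\lceil\sigma\rceil_A$ (one for each type $A$): $R_\iota(d,t)$ iff for all $A$, $\mathsf{enc}_A(d)\approx_{\mathsf{ChD}_A(\iota)}[\![t_A]\!]$; $R_{\sigma_1\Rightarrow\sigma_2}(f,g)$ iff for all $x\in\mathcal{B}[\![\sigma_1]\!]$ and all families $y$ with $y_A:\lceil\sigma_1\rceil_A$, $R_{\sigma_1}(x,y)$ implies $R_{\sigma_2}(f\,x,(g_A\,y_A)_A)$. -}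

module Defs where

open import Data.Nat using (ℕ; zero; suc)
open import Data.List using (List; []; _∷_)
open import Relation.Binary.PropositionalEquality using (_≡_)

infixr 5 _⇒_
data Ty : Set where
  ι   : Ty
  _⇒_ : Ty → Ty → Ty

Ctx : Set
Ctx = List Ty

data _∋_ : Ctx → Ty → Set where
  here  : ∀ {Γ σ} → (σ ∷ Γ) ∋ σ
  there : ∀ {Γ σ τ} → Γ ∋ σ → (τ ∷ Γ) ∋ σ

data Tm (Γ : Ctx) : Ty → Set where
  var  : ∀ {σ} → Γ ∋ σ → Tm Γ σ
  zero : Tm Γ ι
  succ : Tm Γ (ι ⇒ ι)
  rec  : (σ : Ty) → Tm Γ ((ι ⇒ σ ⇒ σ) ⇒ σ ⇒ ι ⇒ σ)
  lam  : ∀ {σ τ} → Tm (σ ∷ Γ) τ → Tm Γ (σ ⇒ τ)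
  app  : ∀ {σ τ} → Tm Γ (σ ⇒ τ) → Tm Γ σ → Tm Γ τ

Closed : Ty → Set
Closed σ = Tm [] σ

⟦_⟧ty : Ty → Set
⟦ ι ⟧ty = ℕ
⟦ σ ⇒ τ ⟧ty = ⟦ σ ⟧ty → ⟦ τ ⟧ty

data Env : Ctx → Set where
  []  : Env []
  _∷_ : ∀ {Γ σ} → ⟦ σ ⟧ty → Env Γ → Env (σ ∷ Γ)

lookupEnv : ∀ {Γ σ} → Env Γ → Γ ∋ σ → ⟦ σ ⟧ty
lookupEnv (v ∷ ρ) here = v
lookupEnv (v ∷ ρ) (there i) = lookupEnv ρ i

primrec : ∀ {X : Set} → (ℕ → X → X) → X → ℕ → X
primrec f a zero = a
primrec f a (suc n) = f n (primrec f a n)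

⟦_⟧tm : ∀ {Γ σ} → Tm Γ σ → Env Γ → ⟦ σ ⟧ty
⟦ var i ⟧tm ρ = lookupEnv ρ i
⟦ zero ⟧tm ρ = zero
⟦ succ ⟧tm ρ = suc
⟦ rec σ ⟧tm ρ = primrec
⟦ lam t ⟧tm ρ = λ v → ⟦ t ⟧tm (v ∷ ρ)
⟦ app t u ⟧tm ρ = ⟦ t ⟧tm ρ (⟦ u ⟧tm ρ)

⟦_⟧ : ∀ {σ} → Closed σ → ⟦ σ ⟧ty
⟦ t ⟧ = ⟦ t ⟧tm []

Ext : (σ : Ty) → ⟦ σ ⟧ty → ⟦ σ ⟧ty → Set
Ext ι n m = n ≡ m
Ext (σ₁ ⇒ σ₂) f g = ∀ x y → Ext σ₁ x y → Ext σ₂ (f x) (g y)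

-- dialogue trees D_ℕ ℕ
data D : Set where
  η : ℕ → D
  β : (ℕ → D) → ℕ → D

B⟦_⟧ : Ty → Set
B⟦ ι ⟧ = D
B⟦ σ ⇒ τ ⟧ = B⟦ σ ⟧ → B⟦ τ ⟧

-- internal (Church-encoded) dialogue trees
ChD : Ty → Ty → Ty
ChD A σ = (σ ⇒ A) ⇒ ((ι ⇒ A) ⇒ ι ⇒ A) ⇒ A

-- η_A := λ z e b. e z
ηT : (A : Ty) → Closed (ι ⇒ ChD A ι)
ηT A = lam (lam (lam (app (var (there here)) (var (there (there here))))))

-- β_A := λ φ x e b. b (λ y. φ y e b) x
βT : (A : Ty) → Closed ((ι ⇒ ChD A ι) ⇒ ι ⇒ ChD A ι)
βT A = lam (lam (lam (lam
  (app (app (var here)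
            (lam (app (app (app (var (there (there (there (there here)))))
                                (var here))
                           (var (there (there here))))
                      (var (there here)))))
       (var (there (there here)))))))

⌈_⌉ : Ty → Ty → Ty
⌈ ι ⌉ A = ChD A ι
⌈ σ ⇒ τ ⌉ A = ⌈ σ ⌉ A ⇒ ⌈ τ ⌉ A

enc : (A : Ty) → D → ⟦ ChD A ι ⟧ty
enc A (η z) = ⟦ ηT A ⟧ z
enc A (β φ x) = ⟦ βT A ⟧ (λ n → enc A (φ n)) x

Family : Ty → Set
Family σ = (A : Ty) → Closed (⌈ σ ⌉ A)

R : (σ : Ty) → B⟦ σ ⟧ → Family σ → Set
R ι d t = (A : Ty) → Ext (ChD A ι) (enc A d) ⟦ t A ⟧
R (σ₁ ⇒ σ₂) f g = (x : B⟦ σ₁ ⟧) (y : Family σ₁) → R σ₁ x y → R σ₂ (f x) (λ A → app (g A) (y A))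

module Submission where

open import Defs
open import Data.Nat using (ℕ; zero; suc)
open import Data.List using ([]; _∷_)
open import Relation.Binary.PropositionalEquality using (_≡_; refl; sym; trans; cong)

-- Hereditarily extensional equality is a partial equivalence relation; at
-- arrow types it is not reflexive in general, so transitivity uses the
-- reflexivity b ≈ b that follows from a ≈ b by symmetry and transitivity.

Ext-sym : (σ : Ty) {a b : ⟦ σ ⟧ty} → Ext σ a b → Ext σ b a
Ext-sym ι a≡b = sym a≡b
Ext-sym (σ ⇒ τ) f≈g x y x≈y = Ext-sym τ (f≈g y x (Ext-sym σ x≈y))

Ext-trans : (σ : Ty) {a b c : ⟦ σ ⟧ty} → Ext σ a b → Ext σ b c → Ext σ a c
Ext-trans ι a≡b b≡c = trans a≡b b≡c
Ext-trans (σ ⇒ τ) f≈g g≈h x y x≈y =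
  Ext-trans τ (f≈g x y x≈y) (g≈h y y (Ext-trans σ (Ext-sym σ x≈y) x≈y))

data EnvExt : (Γ : Ctx) → Env Γ → Env Γ → Set where
  []  : EnvExt [] [] []
  _∷_ : ∀ {Γ σ a b ρ ρ'} → Ext σ a b → EnvExt Γ ρ ρ' → EnvExt (σ ∷ Γ) (a ∷ ρ) (b ∷ ρ')

lookupEnv-Ext : ∀ {Γ σ ρ ρ'} → EnvExt Γ ρ ρ' → (i : Γ ∋ σ) →
  Ext σ (lookupEnv ρ i) (lookupEnv ρ' i)
lookupEnv-Ext (a≈b ∷ _) here = a≈b
lookupEnv-Ext (_ ∷ ρ≈ρ') (there i) = lookupEnv-Ext ρ≈ρ' i

primrec-Ext : (σ : Ty) → Ext ((ι ⇒ σ ⇒ σ) ⇒ σ ⇒ ι ⇒ σ) primrec primrec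
primrec-Ext σ f g f≈g a b a≈b n .n refl = go n
  where
    go : (n : ℕ) → Ext σ (primrec f a n) (primrec g b n)
    go zero = a≈b
    go (suc n) = f≈g n n refl _ _ (go n)

⟦⟧tm-Ext : ∀ {Γ σ} (t : Tm Γ σ) {ρ ρ'} → EnvExt Γ ρ ρ' →
  Ext σ (⟦ t ⟧tm ρ) (⟦ t ⟧tm ρ')
⟦⟧tm-Ext (var i) ρ≈ρ' = lookupEnv-Ext ρ≈ρ' i
⟦⟧tm-Ext zero _ = refl
⟦⟧tm-Ext succ _ _ _ = cong suc
⟦⟧tm-Ext (rec σ) _ = primrec-Ext σ
⟦⟧tm-Ext (lam t) ρ≈ρ' _ _ x≈y = ⟦⟧tm-Ext t (x≈y ∷ ρ≈ρ')
⟦⟧tm-Ext (app t u) ρ≈ρ' = ⟦⟧tm-Ext t ρ≈ρ' _ _ (⟦⟧tm-Ext u ρ≈ρ')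

⟦⟧-Ext-refl : ∀ {σ} (t : Closed σ) → Ext σ ⟦ t ⟧ ⟦ t ⟧
⟦⟧-Ext-refl t = ⟦⟧tm-Ext t []

-- At arrow types the arguments y_A are shared by both sides, so the
-- hypothesis is applied to ⟦ y_A ⟧ ≈ ⟦ y_A ⟧, which holds because every
-- term denotes a hereditarily extensional value.
lemma29 : (σ : Ty) (x : B⟦ σ ⟧) (t s : Family σ) →
    ((A : Ty) → Ext (⌈ σ ⌉ A) ⟦ t A ⟧ ⟦ s A ⟧) →
    R σ x t → R σ x s
lemma29 ι d t s t≈s Rdt A = Ext-trans (ChD A ι) (Rdt A) (t≈s A)
lemma29 (σ₁ ⇒ σ₂) f t s t≈s Rft x y Rxy =
  lemma29 σ₂ (f x) (λ A → app (t A) (y A)) (λ A → app (s A) (y A))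
    (λ A → t≈s A _ _ (⟦⟧-Ext-refl (y A)))
    (Rft x y Rxy)
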